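{- For any identity $\varphi \approx \psi$ of type $\langle 2,1\rangle$ (binary $\lor$, unary $\lnot$), the following are equivalent: (1) $\mathbf{IS}_2\times\mathbf{IS}_3 \vDash \varphi \approx \psi$; (2) $\mathcal{RBISL} \vDash \varphi \approx \psi$; (3) $\varphi \approx \psi$ is regular bipolarly balanced.
   Context: An involutive semilattice is an algebra $\langle I,\lor,\lnot\rangle$ of type $\langle 2,1\rangle$ where $\langle I,\lor\rangle$ is a semilattice and $\lnot\lnot x\approx x$, $\lnot(x\lor y)\approx \lnot x\lor\lnot y$ hold; $\mathcal{ISL}$ is the variety of involutive semilattices. $\mathcal{RBISL}$ is the subvariety of $\mathcal{ISL}$ axiomatised (relative to $\mathcal{ISL}$) by $(x\lor\lnot x)\lor y\approx (x\lor \lnot x)\lor \lnot y$. $\mathbf{IS}_2$ is the 2-element involutive semilattice $\{\mathbf{i},\mathbf{j}\}$ with $\mathbf{i}<\mathbf{j}$ and $\lnot$ the identity map. $\mathbf{IS}_3$ is the 3-element involutive semilattice with universe $\{\mathbf{i},\lnot\mathbf{i},\mathbf{j}\}$, where $\mathbf{i}\neq\lnot\mathbf{i}$, $\lnot\mathbf{j}=\mathbf{j}$, $\mathbf{j}$ is the top and $\mathbf{i}\lor\lnot\mathbf{i}=\mathbf{j}$. For a term $\varphi$, $Var(\varphi)$ is its set of variables, and $Var^{+}(\varphi)$ (resp. $Var^{ - }(\varphi)$) is the set of variables having an occurrence within the scope of an even (resp. odd) number of occurrences of $\lnot$. An identity $\varphi\approx\psi$ is regular if $Var(\varphi)=Var(\psi)$;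 balanced regular if $Var^+(\varphi)=Var^+(\psi)$ and $Var^-(\varphi)=Var^-(\psi)$; bipolar if $Var^+(\varphi)\cap Var^-(\varphi)\neq\emptyset$ and $Var^+(\psi)\cap Var^-(\psi)\neq\emptyset$; regular bipolarly balanced if it is either both bipolar and regular, or balanced regular. -}

module Defs where

open import Data.Nat using (ℕ)
open import Data.Bool using (Bool; true; false; _∨_)
open import Data.Product using (_×_; _,_; proj₁; proj₂; ∃)
open import Relation.Binary.PropositionalEquality using (_≡_)
open import Function.Bundles using (_⇔_)
open import Data.Sum using (_⊎_)

data Term : Set where
  var  : ℕ → Term
  _∨ₜ_ : Term → Term → Term
  ¬ₜ_  : Term → Term

record Identity : Set where
  constructor _≈ᵢ_
  field
    lhs : Term
    rhs : Term
open Identity public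

record Alg21 : Set₁ where
  field
    Carrier : Set
    join    : Carrier → Carrier → Carrier
    neg     : Carrier → Carrier
open Alg21 public

⟦_⟧ : Term → (A : Alg21) → (ℕ → Carrier A) → Carrier A
⟦ var x ⟧    A ρ = ρ x
⟦ φ ∨ₜ ψ ⟧  A ρ = join A (⟦ φ ⟧ A ρ) (⟦ ψ ⟧ A ρ)
⟦ ¬ₜ φ ⟧    A ρ = neg A (⟦ φ ⟧ A ρ)

_⊨_ : Alg21 → Identity → Set
A ⊨ e = (ρ : ℕ → Carrier A) → ⟦ lhs e ⟧ A ρ ≡ ⟦ rhs e ⟧ A ρ

record IsISL (A : Alg21) : Set where
  private
    _⊔_ = join A
    ∼_  = neg A
  field
    assoc  : ∀ x y z → (x ⊔ y) ⊔ z ≡ x ⊔ (y ⊔ z)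
    comm   : ∀ x y → x ⊔ y ≡ y ⊔ x
    idem   : ∀ x → x ⊔ x ≡ x
    invol  : ∀ x → ∼ (∼ x) ≡ x
    negjoin : ∀ x y → ∼ (x ⊔ y) ≡ (∼ x) ⊔ (∼ y)

record IsRBISL (A : Alg21) : Set where
  field
    isISL : IsISL A
    rb    : ∀ x y → join A (join A x (neg A x)) y ≡ join A (join A x (neg A x)) (neg A y)

RBISL⊨ : Identity → Set₁
RBISL⊨ e = (A : Alg21) → IsRBISL A → A ⊨ e

-- IS₂ = {i < j}, ¬ = identity. Encoded as Bool (false = i, true = j).
IS₂ : Alg21
IS₂ = record { Carrier = Bool ; join = _∨_ ; neg = λ x → x }

-- IS₃ = {i, ¬i, j}, j top, i ∨ ¬i = j, ¬j = j.
data E₃ : Set where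
  i ni j : E₃

join₃ : E₃ → E₃ → E₃
join₃ i  i  = i
join₃ ni ni = ni
join₃ _  _  = j

neg₃ : E₃ → E₃
neg₃ i  = ni
neg₃ ni = i
neg₃ j  = j

IS₃ : Alg21
IS₃ = record { Carrier = E₃ ; join = join₃ ; neg = neg₃ }

_×ₐ_ : Alg21 → Alg21 → Alg21
A ×ₐ B = record
  { Carrier = Carrier A × Carrier B
  ; join = λ p q → join A (proj₁ p) (proj₁ q) , join B (proj₂ p) (proj₂ q)
  ; neg  = λ p → neg A (proj₁ p) , neg B (proj₂ p)
  }

data Occ (x : ℕ) : Term → Set where
  here : Occ x (var x)
  ∨l   : ∀ {φ ψ} → Occ x φ → Occ x (φ ∨ₜ ψ)
  ∨r   : ∀ {φ ψ} → Occ x ψ → Occ x (φ ∨ₜ ψ)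
  ¬o   : ∀ {φ} → Occ x φ → Occ x (¬ₜ φ)

-- x ∈ Var⁺(φ) / x ∈ Var⁻(φ): an occurrence under an even / odd number of ¬
mutual
  data Pos (x : ℕ) : Term → Set where
    here : Pos x (var x)
    ∨l   : ∀ {φ ψ} → Pos x φ → Pos x (φ ∨ₜ ψ)
    ∨r   : ∀ {φ ψ} → Pos x ψ → Pos x (φ ∨ₜ ψ)
    ¬n   : ∀ {φ} → Neg x φ → Pos x (¬ₜ φ)

  data Neg (x : ℕ) : Term → Set where
    ∨l   : ∀ {φ ψ} → Neg x φ → Neg x (φ ∨ₜ ψ)
    ∨r   : ∀ {φ ψ} → Neg x ψ → Neg x (φ ∨ₜ ψ)
    ¬p   : ∀ {φ} → Pos x φ → Neg x (¬ₜ φ)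

Regular : Identity → Set
Regular e = ∀ x → Occ x (lhs e) ⇔ Occ x (rhs e)

BalancedRegular : Identity → Set
BalancedRegular e = ∀ x → (Pos x (lhs e) ⇔ Pos x (rhs e)) × (Neg x (lhs e) ⇔ Neg x (rhs e))

Bipolar : Identity → Set
Bipolar e = (∃ λ x → Pos x (lhs e) × Neg x (lhs e)) × (∃ λ y → Pos y (rhs e) × Neg y (rhs e))

RegularBipolarlyBalanced : Identity → Set
RegularBipolarlyBalanced e = (Bipolar e × Regular e) ⊎ BalancedRegular e

-- Over involutive semilattices a term evaluates to the join of its literals:
-- ρ x for x ∈ Var⁺ and ¬ ρ x for x ∈ Var⁻. Balanced regular identities
-- therefore hold in every involutive semilattice. In an RBISL, once a term has
-- a bipolar variable y its value lies above y ∨ ¬y, which makes a ≤ t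
-- equivalent to ¬a ≤ t; so only the variables matter and bipolar regular
-- identities hold as well. Conversely, IS₂ detects the set of variables, and in
-- IS₃ a bipolar term is constantly j, while a non-bipolar term takes the value i
-- under the valuation i on Var⁺, ¬i on Var⁻; comparing both sides under such
-- valuations yields balancedness whenever one side is not bipolar.
module Submission where

open import Defs
open import Data.Bool using (Bool; false; T; if_then_else_)
open import Data.Bool.Properties using (∨-assoc; ∨-comm; ∨-idem; T-∨)
open import Data.List using (List; []; _∷_; _++_)
open import Data.List.Membership.Propositional using (_∈_; lose)
open import Data.List.Membership.Propositional.Properties using (∈-++⁺ˡ; ∈-++⁺ʳ)
open import Data.List.Relation.Unary.Any as Any using (any?; satisfied)
open import Data.Nat using (ℕ; _≟_; _≡ᵇ_)
open import Data.Nat.Properties using (≡ᵇ⇒≡; ≡⇒≡ᵇ)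
open import Data.Product using (_×_; _,_; proj₁; proj₂; ∃)
open import Data.Sum as Sum using (_⊎_; inj₁; inj₂; [_,_])
open import Function using (_∘_)
open import Function.Bundles using (_⇔_; mk⇔; Equivalence)
open import Relation.Nullary using (Dec; yes; no; does; ¬_; contradiction)
open import Relation.Nullary.Decidable using (map′; _×-dec_; _⊎-dec_)
open import Relation.Binary.PropositionalEquality using (_≡_; refl; sym; trans; cong; cong₂; subst; module ≡-Reasoning)
open ≡-Reasoning

open Equivalence using (to; from)

mutual
  Pos⇒Occ : ∀ {x φ} → Pos x φ → Occ x φ
  Pos⇒Occ here   = here
  Pos⇒Occ (∨l p) = ∨l (Pos⇒Occ p)
  Pos⇒Occ (∨r p) = ∨r (Pos⇒Occ p)
  Pos⇒Occ (¬n n) = ¬o (Neg⇒Occ n)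

  Neg⇒Occ : ∀ {x φ} → Neg x φ → Occ x φ
  Neg⇒Occ (∨l n) = ∨l (Neg⇒Occ n)
  Neg⇒Occ (∨r n) = ∨r (Neg⇒Occ n)
  Neg⇒Occ (¬p p) = ¬o (Pos⇒Occ p)

Occ⇒Pos⊎Neg : ∀ {x φ} → Occ x φ → Pos x φ ⊎ Neg x φ
Occ⇒Pos⊎Neg here   = inj₁ here
Occ⇒Pos⊎Neg (∨l o) = Sum.map ∨l ∨l (Occ⇒Pos⊎Neg o)
Occ⇒Pos⊎Neg (∨r o) = Sum.map ∨r ∨r (Occ⇒Pos⊎Neg o)
Occ⇒Pos⊎Neg (¬o o) = Sum.swap (Sum.map ¬p ¬n (Occ⇒Pos⊎Neg o))

mutual
  pos? : ∀ x φ → Dec (Pos x φ)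
  pos? x (var y)  = map′ (λ { refl → here }) (λ { here → refl }) (y ≟ x)
  pos? x (φ ∨ₜ ψ) = map′ [ ∨l , ∨r ] (λ { (∨l p) → inj₁ p ; (∨r p) → inj₂ p })
                         (pos? x φ ⊎-dec pos? x ψ)
  pos? x (¬ₜ φ)   = map′ ¬n (λ { (¬n n) → n }) (neg? x φ)

  neg? : ∀ x φ → Dec (Neg x φ)
  neg? x (var y)  = no λ ()
  neg? x (φ ∨ₜ ψ) = map′ [ ∨l , ∨r ] (λ { (∨l n) → inj₁ n ; (∨r n) → inj₂ n })
                         (neg? x φ ⊎-dec neg? x ψ)
  neg? x (¬ₜ φ)   = map′ ¬p (λ { (¬p p) → p }) (pos? x φ)

vars : Term → List ℕ
vars (var x)  = x ∷ []
vars (φ ∨ₜ ψ) = vars φ ++ vars ψ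
vars (¬ₜ φ)   = vars φ

Occ⇒∈vars : ∀ {x φ} → Occ x φ → x ∈ vars φ
Occ⇒∈vars here           = Any.here refl
Occ⇒∈vars (∨l o)         = ∈-++⁺ˡ (Occ⇒∈vars o)
Occ⇒∈vars (∨r {φ = φ} o) = ∈-++⁺ʳ (vars φ) (Occ⇒∈vars o)
Occ⇒∈vars (¬o o)         = Occ⇒∈vars o

BipolarTerm : Term → Set
BipolarTerm φ = ∃ λ x → Pos x φ × Neg x φ

bipolar? : ∀ φ → Dec (BipolarTerm φ)
bipolar? φ = map′ satisfied (λ (x , p , n) → lose (Occ⇒∈vars (Pos⇒Occ p)) (p , n))
                  (any? (λ x → pos? x φ ×-dec neg? x φ) (vars φ))

module _ (A B : Alg21) where

  ⟦⟧-proj₁ : ∀ φ ρ → proj₁ (⟦ φ ⟧ (A ×ₐ B) ρ) ≡ ⟦ φ ⟧ A (proj₁ ∘ ρ)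
  ⟦⟧-proj₁ (var x)  ρ = refl
  ⟦⟧-proj₁ (φ ∨ₜ ψ) ρ = cong₂ (join A) (⟦⟧-proj₁ φ ρ) (⟦⟧-proj₁ ψ ρ)
  ⟦⟧-proj₁ (¬ₜ φ)   ρ = cong (neg A) (⟦⟧-proj₁ φ ρ)

  ⟦⟧-proj₂ : ∀ φ ρ → proj₂ (⟦ φ ⟧ (A ×ₐ B) ρ) ≡ ⟦ φ ⟧ B (proj₂ ∘ ρ)
  ⟦⟧-proj₂ (var x)  ρ = refl
  ⟦⟧-proj₂ (φ ∨ₜ ψ) ρ = cong₂ (join B) (⟦⟧-proj₂ φ ρ) (⟦⟧-proj₂ ψ ρ)
  ⟦⟧-proj₂ (¬ₜ φ)   ρ = cong (neg B) (⟦⟧-proj₂ φ ρ)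

  ×ₐ-⊨ˡ : ∀ φ ψ → Carrier B → (A ×ₐ B) ⊨ (φ ≈ᵢ ψ) → A ⊨ (φ ≈ᵢ ψ)
  ×ₐ-⊨ˡ φ ψ b H ρ = begin
    ⟦ φ ⟧ A ρ                 ≡⟨ ⟦⟧-proj₁ φ σ ⟨
    proj₁ (⟦ φ ⟧ (A ×ₐ B) σ)  ≡⟨ cong proj₁ (H σ) ⟩
    proj₁ (⟦ ψ ⟧ (A ×ₐ B) σ)  ≡⟨ ⟦⟧-proj₁ ψ σ ⟩
    ⟦ ψ ⟧ A ρ                 ∎
    where
    σ : ℕ → Carrier A × Carrier B
    σ x = ρ x , b

  ×ₐ-⊨ʳ : ∀ φ ψ → Carrier A → (A ×ₐ B) ⊨ (φ ≈ᵢ ψ) → B ⊨ (φ ≈ᵢ ψ)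
  ×ₐ-⊨ʳ φ ψ a H ρ = begin
    ⟦ φ ⟧ B ρ                 ≡⟨ ⟦⟧-proj₂ φ σ ⟨
    proj₂ (⟦ φ ⟧ (A ×ₐ B) σ)  ≡⟨ cong proj₂ (H σ) ⟩
    proj₂ (⟦ ψ ⟧ (A ×ₐ B) σ)  ≡⟨ ⟦⟧-proj₂ ψ σ ⟩
    ⟦ ψ ⟧ B ρ                 ∎
    where
    σ : ℕ → Carrier A × Carrier B
    σ x = a , ρ x

  ×ₐ-isISL : IsISL A → IsISL B → IsISL (A ×ₐ B)
  ×ₐ-isISL isA isB = record
    { assoc   = λ (a , b) (c , d) (e , f) → cong₂ _,_ (A.assoc a c e) (B.assoc b d f)
    ; comm    = λ (a , b) (c , d) → cong₂ _,_ (A.comm a c) (B.comm b d)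
    ; idem    = λ (a , b) → cong₂ _,_ (A.idem a) (B.idem b)
    ; invol   = λ (a , b) → cong₂ _,_ (A.invol a) (B.invol b)
    ; negjoin = λ (a , b) (c , d) → cong₂ _,_ (A.negjoin a c) (B.negjoin b d)
    }
    where
    module A = IsISL isA
    module B = IsISL isB

  ×ₐ-isRBISL : IsRBISL A → IsRBISL B → IsRBISL (A ×ₐ B)
  ×ₐ-isRBISL rbA rbB = record
    { isISL = ×ₐ-isISL (IsRBISL.isISL rbA) (IsRBISL.isISL rbB)
    ; rb    = λ (a , b) (c , d) → cong₂ _,_ (IsRBISL.rb rbA a c) (IsRBISL.rb rbB b d)
    }

IS₂-isRBISL : IsRBISL IS₂
IS₂-isRBISL = record
  { isISL = record
    { assoc   = ∨-assoc
    ; comm    = ∨-comm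
    ; idem    = ∨-idem
    ; invol   = λ _ → refl
    ; negjoin = λ _ _ → refl
    }
  ; rb = λ _ _ → refl
  }

join₃-assoc : ∀ x y z → join₃ (join₃ x y) z ≡ join₃ x (join₃ y z)
join₃-assoc i  i  i  = refl
join₃-assoc i  i  ni = refl
join₃-assoc i  ni i  = refl
join₃-assoc i  ni ni = refl
join₃-assoc ni i  i  = refl
join₃-assoc ni i  ni = refl
join₃-assoc ni ni i  = refl
join₃-assoc ni ni ni = refl
join₃-assoc i  i  j  = refl
join₃-assoc i  ni j  = refl
join₃-assoc ni i  j  = refl
join₃-assoc ni ni j  = refl
join₃-assoc i  j  z  = refl
join₃-assoc ni j  z  = refl
join₃-assoc j  y  z  = refl

join₃-comm : ∀ x y → join₃ x y ≡ join₃ y x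
join₃-comm i  i  = refl
join₃-comm i  ni = refl
join₃-comm i  j  = refl
join₃-comm ni i  = refl
join₃-comm ni ni = refl
join₃-comm ni j  = refl
join₃-comm j  i  = refl
join₃-comm j  ni = refl
join₃-comm j  j  = refl

join₃-idem : ∀ x → join₃ x x ≡ x
join₃-idem i  = refl
join₃-idem ni = refl
join₃-idem j  = refl

neg₃-invol : ∀ x → neg₃ (neg₃ x) ≡ x
neg₃-invol i  = refl
neg₃-invol ni = refl
neg₃-invol j  = refl

neg₃-join₃ : ∀ x y → neg₃ (join₃ x y) ≡ join₃ (neg₃ x) (neg₃ y)
neg₃-join₃ i  i  = refl
neg₃-join₃ i  ni = refl
neg₃-join₃ i  j  = refl
neg₃-join₃ ni i  = refl
neg₃-join₃ ni ni = refl
neg₃-join₃ ni j  = refl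
neg₃-join₃ j  y  = refl

IS₃-isISL : IsISL IS₃
IS₃-isISL = record
  { assoc   = join₃-assoc
  ; comm    = join₃-comm
  ; idem    = join₃-idem
  ; invol   = neg₃-invol
  ; negjoin = neg₃-join₃
  }

-- x ∨ ¬x is the top j for every x of IS₃.
IS₃-isRBISL : IsRBISL IS₃
IS₃-isRBISL = record
  { isISL = IS₃-isISL
  ; rb    = λ { i _ → refl ; ni _ → refl ; j _ → refl }
  }

module ISLOrder {A : Alg21} (isISL : IsISL A) where

  open IsISL isISL

  infix 4 _≤_
  infixl 6 _⊔_
  infix 8 ∼_

  _⊔_ : Carrier A → Carrier A → Carrier A
  _⊔_ = join A

  ∼_ : Carrier A → Carrier A
  ∼_ = neg A

  _≤_ : Carrier A → Carrier A → Set
  a ≤ b = a ⊔ b ≡ b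

  ≤-antisym : ∀ {a b} → a ≤ b → b ≤ a → a ≡ b
  ≤-antisym {a} {b} a≤b b≤a = trans (sym b≤a) (trans (comm b a) a≤b)

  ≤-trans : ∀ {a b c} → a ≤ b → b ≤ c → a ≤ c
  ≤-trans {a} {b} {c} a≤b b≤c = begin
    a ⊔ c        ≡⟨ cong (a ⊔_) b≤c ⟨
    a ⊔ (b ⊔ c)  ≡⟨ assoc a b c ⟨
    (a ⊔ b) ⊔ c  ≡⟨ cong (_⊔ c) a≤b ⟩
    b ⊔ c        ≡⟨ b≤c ⟩
    c            ∎

  x≤x⊔y : ∀ a b → a ≤ a ⊔ b
  x≤x⊔y a b = trans (sym (assoc a a b)) (cong (_⊔ b) (idem a))

  y≤x⊔y : ∀ a b → b ≤ a ⊔ b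
  y≤x⊔y a b = subst (b ≤_) (comm b a) (x≤x⊔y b a)

  ⊔-lub : ∀ {a b c} → a ≤ c → b ≤ c → a ⊔ b ≤ c
  ⊔-lub {a} {b} {c} a≤c b≤c = trans (assoc a b c) (trans (cong (a ⊔_) b≤c) a≤c)

  ∼-mono-≤ : ∀ {a b} → a ≤ b → ∼ a ≤ ∼ b
  ∼-mono-≤ {a} {b} a≤b = trans (sym (negjoin a b)) (cong ∼_ a≤b)

  ∼≤⇒≤∼ : ∀ {a b} → ∼ a ≤ b → a ≤ ∼ b
  ∼≤⇒≤∼ {a} {b} ∼a≤b = subst (_≤ ∼ b) (invol a) (∼-mono-≤ ∼a≤b)

  ≤∼⇒∼≤ : ∀ {a b} → a ≤ ∼ b → ∼ a ≤ b
  ≤∼⇒∼≤ {a} {b} a≤∼b = subst (∼ a ≤_) (invol b) (∼-mono-≤ a≤∼b)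

  module _ (ρ : ℕ → Carrier A) where

    mutual
      Pos⇒≤⟦⟧ : ∀ {x φ} → Pos x φ → ρ x ≤ ⟦ φ ⟧ A ρ
      Pos⇒≤⟦⟧ here                = idem _
      Pos⇒≤⟦⟧ (∨l {ψ = ψ} p)      = ≤-trans (Pos⇒≤⟦⟧ p) (x≤x⊔y _ (⟦ ψ ⟧ A ρ))
      Pos⇒≤⟦⟧ (∨r {φ = φ} p)      = ≤-trans (Pos⇒≤⟦⟧ p) (y≤x⊔y (⟦ φ ⟧ A ρ) _)
      Pos⇒≤⟦⟧ (¬n n)              = ∼≤⇒≤∼ (Neg⇒∼≤⟦⟧ n)

      Neg⇒∼≤⟦⟧ : ∀ {x φ} → Neg x φ → ∼ ρ x ≤ ⟦ φ ⟧ A ρ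
      Neg⇒∼≤⟦⟧ (∨l {ψ = ψ} n)     = ≤-trans (Neg⇒∼≤⟦⟧ n) (x≤x⊔y _ (⟦ ψ ⟧ A ρ))
      Neg⇒∼≤⟦⟧ (∨r {φ = φ} n)     = ≤-trans (Neg⇒∼≤⟦⟧ n) (y≤x⊔y (⟦ φ ⟧ A ρ) _)
      Neg⇒∼≤⟦⟧ (¬p p)             = ∼-mono-≤ (Pos⇒≤⟦⟧ p)

    ⟦⟧≤ : ∀ φ {c} → (∀ {x} → Pos x φ → ρ x ≤ c) → (∀ {x} → Neg x φ → ∼ ρ x ≤ c) →
          ⟦ φ ⟧ A ρ ≤ c
    ⟦⟧≤ (var x)  pos≤ neg≤ = pos≤ here
    ⟦⟧≤ (φ ∨ₜ ψ) pos≤ neg≤ =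
      ⊔-lub (⟦⟧≤ φ (pos≤ ∘ ∨l) (neg≤ ∘ ∨l)) (⟦⟧≤ ψ (pos≤ ∘ ∨r) (neg≤ ∘ ∨r))
    ⟦⟧≤ (¬ₜ φ)   pos≤ neg≤ =
      ≤∼⇒∼≤ (⟦⟧≤ φ (∼≤⇒≤∼ ∘ neg≤ ∘ ¬p) (∼-mono-≤ ∘ pos≤ ∘ ¬n))

    polarities-⊆⇒⟦⟧≤ : ∀ φ ψ → (∀ {x} → Pos x φ → Pos x ψ) → (∀ {x} → Neg x φ → Neg x ψ) →
                       ⟦ φ ⟧ A ρ ≤ ⟦ ψ ⟧ A ρ
    polarities-⊆⇒⟦⟧≤ φ ψ pos⊆ neg⊆ = ⟦⟧≤ φ (Pos⇒≤⟦⟧ ∘ pos⊆) (Neg⇒∼≤⟦⟧ ∘ neg⊆)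

module RBISLOrder {A : Alg21} (isRBISL : IsRBISL A) where

  open IsRBISL isRBISL
  open IsISL isISL
  open ISLOrder isISL public

  ∼≤⇒≤-above-complemented : ∀ {y a c} → y ⊔ ∼ y ≤ c → ∼ a ≤ c → a ≤ c
  ∼≤⇒≤-above-complemented {y} {a} {c} e≤c ∼a≤c =
    ≤-trans (y≤x⊔y e a) (subst (_≤ c) e⊔∼a≡e⊔a (⊔-lub e≤c ∼a≤c))
    where
    e : Carrier A
    e = y ⊔ ∼ y

    e⊔∼a≡e⊔a : e ⊔ ∼ a ≡ e ⊔ a
    e⊔∼a≡e⊔a = trans (rb y (∼ a)) (cong (e ⊔_) (invol a))

  module _ (ρ : ℕ → Carrier A) where

    bipolar-∼≤⇒≤ : ∀ {ψ a} → BipolarTerm ψ → ∼ a ≤ ⟦ ψ ⟧ A ρ → a ≤ ⟦ ψ ⟧ A ρ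
    bipolar-∼≤⇒≤ (y , py , ny) =
      ∼≤⇒≤-above-complemented (⊔-lub (Pos⇒≤⟦⟧ ρ py) (Neg⇒∼≤⟦⟧ ρ ny))

    bipolar-Occ⇒≤⟦⟧ : ∀ {x ψ} → BipolarTerm ψ → Occ x ψ →
                      ρ x ≤ ⟦ ψ ⟧ A ρ × ∼ ρ x ≤ ⟦ ψ ⟧ A ρ
    bipolar-Occ⇒≤⟦⟧ {x} {ψ} b o with Occ⇒Pos⊎Neg o
    ... | inj₁ p = Pos⇒≤⟦⟧ ρ p
                 , bipolar-∼≤⇒≤ b (subst (_≤ ⟦ ψ ⟧ A ρ) (sym (invol (ρ x))) (Pos⇒≤⟦⟧ ρ p))
    ... | inj₂ n = bipolar-∼≤⇒≤ b (Neg⇒∼≤⟦⟧ ρ n) , Neg⇒∼≤⟦⟧ ρ n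

    bipolar-Occ-⊆⇒⟦⟧≤ : ∀ φ ψ → BipolarTerm ψ → (∀ {x} → Occ x φ → Occ x ψ) →
                        ⟦ φ ⟧ A ρ ≤ ⟦ ψ ⟧ A ρ
    bipolar-Occ-⊆⇒⟦⟧≤ φ ψ b occ⊆ =
      ⟦⟧≤ ρ φ (proj₁ ∘ bipolar-Occ⇒≤⟦⟧ b ∘ occ⊆ ∘ Pos⇒Occ)
              (proj₂ ∘ bipolar-Occ⇒≤⟦⟧ b ∘ occ⊆ ∘ Neg⇒Occ)

RegularBipolarlyBalanced⇒RBISL⊨ : ∀ φ ψ → RegularBipolarlyBalanced (φ ≈ᵢ ψ) → RBISL⊨ (φ ≈ᵢ ψ)
RegularBipolarlyBalanced⇒RBISL⊨ φ ψ (inj₁ ((bφ , bψ) , reg)) A isRBISL ρ =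
  ≤-antisym (bipolar-Occ-⊆⇒⟦⟧≤ ρ φ ψ bψ (to (reg _))) (bipolar-Occ-⊆⇒⟦⟧≤ ρ ψ φ bφ (from (reg _)))
  where open RBISLOrder isRBISL
RegularBipolarlyBalanced⇒RBISL⊨ φ ψ (inj₂ bal) A isRBISL ρ =
  ≤-antisym (polarities-⊆⇒⟦⟧≤ ρ φ ψ (to (proj₁ (bal _))) (to (proj₂ (bal _))))
            (polarities-⊆⇒⟦⟧≤ ρ ψ φ (from (proj₁ (bal _))) (from (proj₂ (bal _))))
  where open ISLOrder (IsRBISL.isISL isRBISL)

χ : ℕ → ℕ → Bool
χ x y = y ≡ᵇ x

Occ⇔T⟦⟧χ : ∀ {x} φ → Occ x φ ⇔ T (⟦ φ ⟧ IS₂ (χ x))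
Occ⇔T⟦⟧χ {x} φ = mk⇔ Occ⇒T T⇒Occ
  where
  Occ⇒T : ∀ {φ} → Occ x φ → T (⟦ φ ⟧ IS₂ (χ x))
  Occ⇒T here   = ≡⇒≡ᵇ x x refl
  Occ⇒T (∨l o) = from T-∨ (inj₁ (Occ⇒T o))
  Occ⇒T (∨r o) = from T-∨ (inj₂ (Occ⇒T o))
  Occ⇒T (¬o o) = Occ⇒T o

  T⇒Occ : ∀ {φ} → T (⟦ φ ⟧ IS₂ (χ x)) → Occ x φ
  T⇒Occ {var y} t with ≡ᵇ⇒≡ y x t
  ... | refl = here
  T⇒Occ {φ ∨ₜ ψ} t = [ ∨l ∘ T⇒Occ {φ} , ∨r ∘ T⇒Occ {ψ} ] (to T-∨ t)
  T⇒Occ {¬ₜ φ}   t = ¬o (T⇒Occ t)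

IS₂⊨⇒Regular : ∀ φ ψ → IS₂ ⊨ (φ ≈ᵢ ψ) → Regular (φ ≈ᵢ ψ)
IS₂⊨⇒Regular φ ψ H x = mk⇔
  (from (Occ⇔T⟦⟧χ ψ) ∘ subst T (H (χ x)) ∘ to (Occ⇔T⟦⟧χ φ))
  (from (Occ⇔T⟦⟧χ φ) ∘ subst T (sym (H (χ x))) ∘ to (Occ⇔T⟦⟧χ ψ))

module _ where

  open ISLOrder IS₃-isISL

  ≤i⇒≡i : ∀ {a} → a ≤ i → a ≡ i
  ≤i⇒≡i {i} _ = refl

  ≤-and-∼≤⇒≡j : ∀ {a t} → a ≤ t → ∼ a ≤ t → t ≡ j
  ≤-and-∼≤⇒≡j {t = j}  _  _  = refl
  ≤-and-∼≤⇒≡j {j}      j≤t _ = sym j≤t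
  ≤-and-∼≤⇒≡j {i}  {i}  _  ()
  ≤-and-∼≤⇒≡j {i}  {ni} () _
  ≤-and-∼≤⇒≡j {ni} {i}  () _
  ≤-and-∼≤⇒≡j {ni} {ni} _  ()

  bipolar⇒≡j : ∀ {φ} → BipolarTerm φ → ∀ ρ → ⟦ φ ⟧ IS₃ ρ ≡ j
  bipolar⇒≡j (x , p , n) ρ = ≤-and-∼≤⇒≡j (Pos⇒≤⟦⟧ ρ p) (Neg⇒∼≤⟦⟧ ρ n)

  Adapted : Term → (ℕ → E₃) → Set
  Adapted ψ ρ = (∀ {x} → Pos x ψ → ρ x ≡ i) × (∀ {x} → Neg x ψ → ρ x ≡ ni)

  Adapted⇒≡i : ∀ ψ {ρ} → Adapted ψ ρ → ⟦ ψ ⟧ IS₃ ρ ≡ i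
  Adapted⇒≡i ψ {ρ} (pos≡i , neg≡ni) = ≤i⇒≡i (⟦⟧≤ ρ ψ
    (λ p → subst (_≤ i) (sym (pos≡i p)) refl)
    (λ n → subst (λ a → ∼ a ≤ i) (sym (neg≡ni n)) refl))

  ρ⁺ : Term → ℕ → E₃
  ρ⁺ ψ x = if does (pos? x ψ) then i else ni

  ρ⁻ : Term → ℕ → E₃
  ρ⁻ ψ x = if does (neg? x ψ) then ni else i

  ρ⁺-adapted : ∀ {ψ} → ¬ BipolarTerm ψ → Adapted ψ (ρ⁺ ψ)
  ρ⁺-adapted {ψ} nb = pos≡i , neg≡ni
    where
    pos≡i : ∀ {x} → Pos x ψ → ρ⁺ ψ x ≡ i
    pos≡i {x} p with pos? x ψ
    ... | yes _ = refl
    ... | no ∉Pos = contradiction p ∉Pos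

    neg≡ni : ∀ {x} → Neg x ψ → ρ⁺ ψ x ≡ ni
    neg≡ni {x} n with pos? x ψ
    ... | yes p = contradiction (x , p , n) nb
    ... | no _  = refl

  ρ⁻-adapted : ∀ {ψ} → ¬ BipolarTerm ψ → Adapted ψ (ρ⁻ ψ)
  ρ⁻-adapted {ψ} nb = pos≡i , neg≡ni
    where
    pos≡i : ∀ {x} → Pos x ψ → ρ⁻ ψ x ≡ i
    pos≡i {x} p with neg? x ψ
    ... | yes n = contradiction (x , p , n) nb
    ... | no _  = refl

    neg≡ni : ∀ {x} → Neg x ψ → ρ⁻ ψ x ≡ ni
    neg≡ni {x} n with neg? x ψ
    ... | yes _ = refl
    ... | no ∉Neg = contradiction n ∉Neg

  ρ⁺≡i⇒Pos : ∀ {ψ x} → ρ⁺ ψ x ≡ i → Pos x ψ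
  ρ⁺≡i⇒Pos {ψ} {x} e with pos? x ψ
  ... | yes p = p
  ... | no _  = contradiction e λ ()

  ρ⁻≡ni⇒Neg : ∀ {ψ x} → ρ⁻ ψ x ≡ ni → Neg x ψ
  ρ⁻≡ni⇒Neg {ψ} {x} e with neg? x ψ
  ... | yes n = n
  ... | no _  = contradiction e λ ()

  IS₃⊨⇒BipolarTerm : ∀ φ ψ → IS₃ ⊨ (φ ≈ᵢ ψ) → BipolarTerm φ → BipolarTerm ψ
  IS₃⊨⇒BipolarTerm φ ψ H bφ with bipolar? ψ
  ... | yes bψ = bψ
  ... | no nbψ = contradiction j≡i λ ()
    where
    j≡i : j ≡ i
    j≡i = begin
      j                   ≡⟨ bipolar⇒≡j bφ (ρ⁺ ψ) ⟨
      ⟦ φ ⟧ IS₃ (ρ⁺ ψ)    ≡⟨ H (ρ⁺ ψ) ⟩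
      ⟦ ψ ⟧ IS₃ (ρ⁺ ψ)    ≡⟨ Adapted⇒≡i ψ (ρ⁺-adapted nbψ) ⟩
      i                   ∎

  module _ (φ ψ : Term) (H : IS₃ ⊨ (φ ≈ᵢ ψ)) (nbψ : ¬ BipolarTerm ψ) where

    private
      ⟦φ⟧≡i : ∀ {ρ} → Adapted ψ ρ → ⟦ φ ⟧ IS₃ ρ ≡ i
      ⟦φ⟧≡i {ρ} a = trans (H ρ) (Adapted⇒≡i ψ a)

    IS₃⊨⇒Pos-⊆ : ∀ {x} → Pos x φ → Pos x ψ
    IS₃⊨⇒Pos-⊆ p =
      ρ⁺≡i⇒Pos (≤i⇒≡i (subst (_ ≤_) (⟦φ⟧≡i (ρ⁺-adapted nbψ)) (Pos⇒≤⟦⟧ (ρ⁺ ψ) p)))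

    IS₃⊨⇒Neg-⊆ : ∀ {x} → Neg x φ → Neg x ψ
    IS₃⊨⇒Neg-⊆ {x} n = ρ⁻≡ni⇒Neg (trans (sym (neg₃-invol (ρ⁻ ψ x))) (cong neg₃ ∼ρ⁻x≡i))
      where
      ∼ρ⁻x≡i : ∼ ρ⁻ ψ x ≡ i
      ∼ρ⁻x≡i = ≤i⇒≡i (subst (_ ≤_) (⟦φ⟧≡i (ρ⁻-adapted nbψ)) (Neg⇒∼≤⟦⟧ (ρ⁻ ψ) n))

  IS₃⊨⇒BalancedRegular : ∀ φ ψ → IS₃ ⊨ (φ ≈ᵢ ψ) → ¬ BipolarTerm ψ → BalancedRegular (φ ≈ᵢ ψ)
  IS₃⊨⇒BalancedRegular φ ψ H nbψ x =
      mk⇔ (IS₃⊨⇒Pos-⊆ φ ψ H nbψ) (IS₃⊨⇒Pos-⊆ ψ φ H⁻¹ nbφ)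
    , mk⇔ (IS₃⊨⇒Neg-⊆ φ ψ H nbψ) (IS₃⊨⇒Neg-⊆ ψ φ H⁻¹ nbφ)
    where
    H⁻¹ : IS₃ ⊨ (ψ ≈ᵢ φ)
    H⁻¹ = sym ∘ H

    nbφ : ¬ BipolarTerm φ
    nbφ = nbψ ∘ IS₃⊨⇒BipolarTerm φ ψ H

IS₂⊨∧IS₃⊨⇒RegularBipolarlyBalanced : ∀ φ ψ → IS₂ ⊨ (φ ≈ᵢ ψ) → IS₃ ⊨ (φ ≈ᵢ ψ) →
                                      RegularBipolarlyBalanced (φ ≈ᵢ ψ)
IS₂⊨∧IS₃⊨⇒RegularBipolarlyBalanced φ ψ H₂ H₃ with bipolar? ψ
... | yes bψ = inj₁ ((IS₃⊨⇒BipolarTerm ψ φ (sym ∘ H₃) bψ , bψ) , IS₂⊨⇒Regular φ ψ H₂)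
... | no nbψ = inj₂ (IS₃⊨⇒BalancedRegular φ ψ H₃ nbψ)

corollary3p4 : (φ ψ : Term) →
    (((IS₂ ×ₐ IS₃) ⊨ (φ ≈ᵢ ψ)) ⇔ RBISL⊨ (φ ≈ᵢ ψ))
    × (RBISL⊨ (φ ≈ᵢ ψ) ⇔ RegularBipolarlyBalanced (φ ≈ᵢ ψ))
corollary3p4 φ ψ =
    mk⇔ (RegularBipolarlyBalanced⇒RBISL⊨ φ ψ ∘ complete) (λ R → R _ IS₂×IS₃-isRBISL)
  , mk⇔ (λ R → complete (R _ IS₂×IS₃-isRBISL)) (RegularBipolarlyBalanced⇒RBISL⊨ φ ψ)
  where
  IS₂×IS₃-isRBISL : IsRBISL (IS₂ ×ₐ IS₃)
  IS₂×IS₃-isRBISL = ×ₐ-isRBISL IS₂ IS₃ IS₂-isRBISL IS₃-isRBISL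

  complete : (IS₂ ×ₐ IS₃) ⊨ (φ ≈ᵢ ψ) → RegularBipolarlyBalanced (φ ≈ᵢ ψ)
  complete H = IS₂⊨∧IS₃⊨⇒RegularBipolarlyBalanced φ ψ
    (×ₐ-⊨ˡ IS₂ IS₃ φ ψ i H) (×ₐ-⊨ʳ IS₂ IS₃ φ ψ false H)
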